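{- Let $\Pi = (\mathcal{A}, \mathcal{E}, \mathcal{R})$ be an ELP and let $\Pi' = (\mathcal{A}', \mathcal{E}, \mathcal{R})$ be an ELP with the same set of rules and the same set of epistemic literals, but with $\mathcal{A}' \supset \mathcal{A}$. Then $\mathrm{CWV}(\Pi) = \mathrm{CWV}(\Pi')$.
   Context: Literals over a set of atoms $\mathcal{A}$ are atoms $a\in\mathcal{A}$ or their default negations $\neg a$. An interpretation is a set $I\subseteq\mathcal{A}$; $I\models a$ iff $a\in I$, and $I\models\neg\varphi$ iff $I\not\models\varphi$. A (ground) logic program is a pair $(\mathcal{A},\mathcal{R})$ of a set of atoms and a set of rules $a_1\vee\cdots\vee a_l\leftarrow a_{l+1},\ldots,a_m,\neg\ell_1,\ldots,\neg\ell_n$ ($a_i\in\mathcal{A}$, $\ell_i$ literals); head $\{a_1,\dots,a_l\}$, positive body $\{a_{l+1},\dots,a_m\}$. $I$ is a model of a rule if, whenever $I$ satisfies all body elements, $I$ contains some head atom. The GL-reduct $\Pi^I$ consists of the rules $\mathrm{head}(r)\leftarrow\mathrm{pbody}(r)$ for all rules $r$ such that $I\models\neg\ell$ for every $\neg\ell$ in the body of $r$. $M\subseteq\mathcal{A}$ is an answer set of $\Pi$ if $M$ is a model of $\Pi$ and no $M'\subsetneq M$ is a model of $\Pi^M$; $\mathrm{AS}(\Pi)$ is the set of answer sets. An epistemic literal is $\mathbf{not}\,\ell$ with $\ell$ a literal. An ELP is a triple $(\mathcal{A},\mathcal{E},\mathcal{R})$, $\mathcal{E}$ a set of epistemic literals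 over $\mathcal{A}$, $\mathcal{R}$ a set of rules $a_1\vee\cdots\vee a_k\leftarrow\ell_1,\ldots,\ell_m,\xi_1,\ldots,\xi_j,\neg\xi_{j+1},\ldots,\neg\xi_n$ with $a_i\in\mathcal{A}$, $\ell_i$ literals, $\xi_i\in\mathcal{E}$. A guess is $\Phi\subseteq\mathcal{E}$. A set $\mathcal{I}$ of interpretations is $\Phi$-compatible w.r.t. $\mathcal{E}$ iff $\mathcal{I}\neq\emptyset$, for each $\mathbf{not}\,\ell\in\Phi$ some $I\in\mathcal{I}$ has $I\not\models\ell$, and for each $\mathbf{not}\,\ell\in\mathcal{E}\setminus\Phi$ all $I\in\mathcal{I}$ satisfy $\ell$. The epistemic reduct $\Pi^\Phi$ is the logic program obtained by replacing each $\mathbf{not}\,\ell\in\Phi$ by $\top$ and every remaining $\mathbf{not}$ by $\neg$ ($\neg\neg\neg a$ treated as $\neg a$). $\mathcal{M}$ is a candidate world view (CWV) of $\Pi$ if for some guess $\Phi$, $\mathcal{M}=\mathrm{AS}(\Pi^\Phi)$ and $\mathcal{M}$ is $\Phi$-compatible w.r.t. $\mathcal{E}$; $\mathrm{CWV}(\Pi)$ is the set of CWVs. -}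

module Defs where

open import Level using (0ℓ)
open import Data.Nat using (ℕ)
import Data.Nat as ℕ
open import Data.List using (List; []; _∷_)
open import Data.List.Relation.Unary.All using (All)
open import Data.List.Membership.Propositional using () renaming (_∈_ to _∈ˡ_)
open import Data.Maybe using (Maybe; just; nothing)
open import Data.Product using (Σ; ∃; _×_; _,_)
open import Relation.Nullary using (¬_; Dec; yes; no)
open import Relation.Binary.PropositionalEquality using (_≡_; refl; cong)
open import Relation.Binary.Definitions using (DecidableEquality)
open import Relation.Unary using (Pred; _∈_; _∉_; _⊂_)
open import Function.Bundles using (_⇔_)

-- Atoms are natural numbers; the atom set 𝒜 of a program is a finite set,
-- represented as a list (membership = list membership).
Atom : Set
Atom = ℕ

-- Literals: an atom a, or its default negation ¬ a.
data Lit : Set where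
  pos : Atom → Lit
  neg : Atom → Lit

data EpLit : Set where
  not : Lit → EpLit

Interp : Set₁
Interp = Pred Atom 0ℓ

_⊨_ : Interp → Lit → Set
I ⊨ pos a = a ∈ I
I ⊨ neg a = ¬ (a ∈ I)

_⊆𝒜_ : Interp → List Atom → Set
I ⊆𝒜 𝒜 = ∀ a → a ∈ I → a ∈ˡ 𝒜

-- Ground (disjunctive) logic programs
-- rule  a₁ ∨ … ∨ aₗ ← a_{l+1}, …, a_m, ¬ℓ₁, …, ¬ℓₙ

record Rule : Set where
  constructor rule
  field
    head  : List Atom
    pbody : List Atom
    nbody : List Lit     -- ℓ ∈ nbody stands for the body element ¬ℓ
open Rule public

record LP : Set where
  constructor lp
  field
    atoms : List Atom
    rules : List Rule
open LP public

ModelRule : Interp → Rule → Set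
ModelRule I r =
  All (λ a → a ∈ I) (pbody r) → All (λ ℓ → ¬ (I ⊨ ℓ)) (nbody r) →
  Σ Atom (λ a → a ∈ˡ head r × a ∈ I)

ModelRules : Interp → List Rule → Set
ModelRules I rs = All (ModelRule I) rs

-- GL-reduct Π^I : rules head(r) ← pbody(r) for rules whose negative body
-- is satisfied by I.  Represented as a predicate on (positive) rules.
record InGLReduct (Π : LP) (I : Interp) (r' : Rule) : Set₁ where
  field
    orig    : Rule
    orig∈   : orig ∈ˡ rules Π
    negSat  : All (λ ℓ → ¬ (I ⊨ ℓ)) (nbody orig)
    shape   : r' ≡ rule (head orig) (pbody orig) []

ModelGL : Interp → LP → Interp → Set₁
ModelGL I Π M = ∀ r → InGLReduct Π M r → ModelRule I r

record IsAnswerSet (Π : LP) (M : Interp) : Set₁ where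
  field
    subset  : M ⊆𝒜 atoms Π
    model   : ModelRules M (rules Π)
    minimal : ¬ (Σ Interp λ M' → (M' ⊂ M) × ModelGL M' Π M)

-- Epistemic logic programs
-- rule  a₁ ∨ … ∨ aₖ ← ℓ₁, …, ℓ_m, ξ₁, …, ξ_j, ¬ξ_{j+1}, …, ¬ξₙ

record ERule : Set where
  constructor erule
  field
    ehead : List Atom
    ebody : List Lit
    epos  : List EpLit
    eneg  : List EpLit    -- ξ_{j+1} … ξₙ  (occurring as ¬ξ)
open ERule public

litAtom : Lit → Atom
litAtom (pos a) = a
litAtom (neg a) = a

epAtom : EpLit → Atom
epAtom (not ℓ) = litAtom ℓ

ERuleOver : List Atom → ERule → Set
ERuleOver 𝒜 r =
  All (λ a → a ∈ˡ 𝒜) (ehead r) ×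
  All (λ ℓ → litAtom ℓ ∈ˡ 𝒜) (ebody r) ×
  All (λ ξ → epAtom ξ ∈ˡ 𝒜) (epos r) ×
  All (λ ξ → epAtom ξ ∈ˡ 𝒜) (eneg r)

record ELP : Set where
  constructor elp
  field
    eatoms  : List Atom
    eplits  : List EpLit
    erules  : List ERule
    eplitsOver : All (λ ξ → epAtom ξ ∈ˡ eatoms) eplits
    erulesOver : All (ERuleOver eatoms) erules
open ELP public

_≟L_ : DecidableEquality Lit
pos a ≟L pos b with a ℕ.≟ b
... | yes refl = yes refl
... | no  p    = no λ { refl → p refl }
pos a ≟L neg b = no λ ()
neg a ≟L pos b = no λ ()
neg a ≟L neg b with a ℕ.≟ b
... | yes refl = yes refl
... | no  p    = no λ { refl → p refl }

_≟E_ : DecidableEquality EpLit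
not ℓ ≟E not ℓ' with ℓ ≟L ℓ'
... | yes refl = yes refl
... | no  p    = no λ { refl → p refl }

open import Data.List.Membership.DecPropositional _≟E_ using (_∈?_)

-- body literals ℓᵢ : atoms go to the positive body, ¬a becomes ¬(pos a)
bodyPos : List Lit → List Atom
bodyPos []            = []
bodyPos (pos a ∷ ls)  = a ∷ bodyPos ls
bodyPos (neg a ∷ ls)  = bodyPos ls

bodyNeg : List Lit → List Lit
bodyNeg []            = []
bodyNeg (pos a ∷ ls)  = bodyNeg ls
bodyNeg (neg a ∷ ls)  = pos a ∷ bodyNeg ls

-- ξ = not ℓ occurring positively: ⊤ if ξ ∈ Φ (dropped), else ¬ℓ
eposRed : List EpLit → List EpLit → List Lit
eposRed Φ []            = []
eposRed Φ (not ℓ ∷ ξs) with not ℓ ∈? Φ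
... | yes _ = eposRed Φ ξs
... | no  _ = ℓ ∷ eposRed Φ ξs

-- ¬ξ with ξ = not ℓ ∉ Φ : ¬¬ℓ, i.e. ¬(neg a) for ℓ = a and
-- ¬¬¬a = ¬a = ¬(pos a) for ℓ = ¬a
dneg : Lit → Lit
dneg (pos a) = neg a
dneg (neg a) = pos a

-- Nothing if some ¬ξ has ξ ∈ Φ (the body contains ¬⊤, i.e. is false)
enegRed : List EpLit → List EpLit → Maybe (List Lit)
enegRed Φ []            = just []
enegRed Φ (not ℓ ∷ ξs) with not ℓ ∈? Φ
... | yes _ = nothing
... | no  _ with enegRed Φ ξs
...   | nothing = nothing
...   | just ls = just (dneg ℓ ∷ ls)

reduceRule : List EpLit → ERule → Maybe Rule
reduceRule Φ r with enegRed Φ (eneg r)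
... | nothing = nothing
... | just ls = just (rule (ehead r) (bodyPos (ebody r))
                       (Data.List._++_ (bodyNeg (ebody r))
                         (Data.List._++_ (eposRed Φ (epos r)) ls)))

reduceRules : List EpLit → List ERule → List Rule
reduceRules Φ []       = []
reduceRules Φ (r ∷ rs) with reduceRule Φ r
... | nothing = reduceRules Φ rs
... | just r' = r' ∷ reduceRules Φ rs

epReduct : ELP → List EpLit → LP
epReduct Π Φ = lp (eatoms Π) (reduceRules Φ (erules Π))

InterpSet : Set₂
InterpSet = Pred Interp (Level.suc 0ℓ)

record Compatible (𝓔 Φ : List EpLit) (𝓜 : InterpSet) : Set₂ where
  field
    nonempty : Σ Interp λ I → I ∈ 𝓜
    inΦ      : ∀ ℓ → not ℓ ∈ˡ Φ → Σ Interp λ I → I ∈ 𝓜 × ¬ (I ⊨ ℓ)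
    notInΦ   : ∀ ℓ → not ℓ ∈ˡ 𝓔 → ¬ (not ℓ ∈ˡ Φ) → ∀ I → I ∈ 𝓜 → I ⊨ ℓ

IsCWV : ELP → InterpSet → Set₂
IsCWV Π 𝓜 =
  Σ (List EpLit) λ Φ →
    All (λ ξ → ξ ∈ˡ eplits Π) Φ ×
    (∀ I → (I ∈ 𝓜) ⇔ IsAnswerSet (epReduct Π Φ) I) ×
    Compatible (eplits Π) Φ 𝓜

module Submission where

-- The atom set 𝒜 of a program enters the definition of a candidate world
-- view only through the side condition "M ⊆ 𝒜" on answer sets of the
-- epistemic reducts Π^Φ; the rules, the guesses and the compatibility
-- condition do not mention it.  The proof therefore has three parts.
--   1. Heads of the rules of Π^Φ are heads of rules of Π, hence lie in 𝒜.
--   2. For any logic program whose rule heads lie in 𝒜, every answer set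
--      is contained in 𝒜: its restriction to 𝒜 is still a model of the
--      GL-reduct, so minimality forbids atoms outside 𝒜.  Consequently the
--      answer sets of (𝒜, 𝓡) and (𝒜', 𝓡) coincide for 𝒜 ⊆ 𝒜'.
--   3. Two ELPs with the same epistemic literals whose reducts have the
--      same answer sets for every guess have the same candidate world views.

open import Defs
open import Data.List using (List; _∷_)
open import Data.List.Membership.Propositional using () renaming (_∈_ to _∈ˡ_)
open import Data.List.Relation.Unary.All as All using (All; []; _∷_)
open import Data.List.Relation.Unary.Any using (here; there)
open import Data.Maybe using (just; nothing)
open import Data.Nat using (_≟_)
open import Data.List.Membership.DecPropositional _≟_ using () renaming (_∈?_ to _∈ℕ?_)
open import Data.Product using (Σ; _×_; _,_; proj₁; proj₂)
open import Function.Bundles using (_⇔_; mk⇔)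
open import Function.Properties.Equivalence as ⇔ using ()
open import Relation.Binary.PropositionalEquality using (_≡_; refl; subst)
open import Relation.Nullary using (¬_; yes; no; contradiction)
open import Relation.Unary using (_∈_; _⊂_)

open IsAnswerSet

HeadsWithin : List Atom → List Rule → Set
HeadsWithin 𝒜 rs = ∀ r → r ∈ˡ rs → ∀ a → a ∈ˡ head r → a ∈ˡ 𝒜

reduceRule-head : ∀ Φ r {r'} → reduceRule Φ r ≡ just r' → head r' ≡ ehead r
reduceRule-head Φ r eq with enegRed Φ (eneg r)
reduceRule-head Φ r refl | just _ = refl

reduceRules-origin : ∀ Φ rs r' → r' ∈ˡ reduceRules Φ rs →
  Σ ERule λ r → r ∈ˡ rs × head r' ≡ ehead r
reduceRules-origin Φ (r ∷ rs) r' r'∈ with reduceRule Φ r in eq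
... | nothing = let (o , o∈ , h) = reduceRules-origin Φ rs r' r'∈ in o , there o∈ , h
... | just _ with r'∈
...   | here refl = r , here refl , reduceRule-head Φ r eq
...   | there r'∈' = let (o , o∈ , h) = reduceRules-origin Φ rs r' r'∈' in o , there o∈ , h

reduct-headsWithin : ∀ 𝒜 Φ rs → All (ERuleOver 𝒜) rs →
  HeadsWithin 𝒜 (reduceRules Φ rs)
reduct-headsWithin 𝒜 Φ rs over r' r'∈ a a∈ with reduceRules-origin Φ rs r' r'∈
... | r , r∈ , h rewrite h = All.lookup (proj₁ (All.lookup over r∈)) a∈

modelGL-atoms : ∀ 𝒜 𝒜' rs M' M → ModelGL M' (lp 𝒜 rs) M → ModelGL M' (lp 𝒜' rs) M
modelGL-atoms 𝒜 𝒜' rs M' M models r' r'∈ = models r' record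
  { orig = orig ; orig∈ = orig∈ ; negSat = negSat ; shape = shape }
  where open InGLReduct r'∈

minimal-atoms : ∀ 𝒜 𝒜' rs M → IsAnswerSet (lp 𝒜 rs) M →
  ¬ (Σ Interp λ M' → (M' ⊂ M) × ModelGL M' (lp 𝒜' rs) M)
minimal-atoms 𝒜 𝒜' rs M as (M' , M'⊂M , models) =
  minimal as (M' , M'⊂M , modelGL-atoms 𝒜' 𝒜 rs M' M models)

restrict : Interp → List Atom → Interp
restrict M 𝒜 a = a ∈ M × a ∈ˡ 𝒜

-- If M is a model of the rules and all heads lie in 𝒜, then M ∩ 𝒜 is a
-- model of Π^M: a reduct rule fires in M, and its chosen head atom is in 𝒜.
restrict-modelGL : ∀ 𝒜 𝒜' rs M → HeadsWithin 𝒜 rs → ModelRules M rs →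
  ModelGL (restrict M 𝒜) (lp 𝒜' rs) M
restrict-modelGL 𝒜 𝒜' rs M heads model r' r'∈ pbody [] with InGLReduct.shape r'∈
... | refl =
  let open InGLReduct r'∈
      (a , a∈head , a∈M) = All.lookup model orig∈ (All.map proj₁ pbody) negSat
  in a , a∈head , a∈M , heads orig orig∈ a a∈head

answerSet-⊆heads : ∀ 𝒜 𝒜' rs M → HeadsWithin 𝒜 rs →
  IsAnswerSet (lp 𝒜' rs) M → M ⊆𝒜 𝒜
answerSet-⊆heads 𝒜 𝒜' rs M heads as a a∈M with a ∈ℕ? 𝒜
... | yes a∈𝒜 = a∈𝒜
... | no  a∉𝒜 = contradiction
  (restrict M 𝒜 , ((λ {_} → proj₁) , λ M⊆ → a∉𝒜 (proj₂ (M⊆ a∈M))) ,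
   restrict-modelGL 𝒜 𝒜' rs M heads (model as))
  (minimal as)

answerSet-enlarge : ∀ 𝒜 𝒜' rs → (∀ a → a ∈ˡ 𝒜 → a ∈ˡ 𝒜') → HeadsWithin 𝒜 rs →
  ∀ M → IsAnswerSet (lp 𝒜 rs) M ⇔ IsAnswerSet (lp 𝒜' rs) M
answerSet-enlarge 𝒜 𝒜' rs 𝒜⊆𝒜' heads M = mk⇔ enlarge shrink
  where
  enlarge : IsAnswerSet (lp 𝒜 rs) M → IsAnswerSet (lp 𝒜' rs) M
  enlarge as = record
    { subset  = λ a a∈M → 𝒜⊆𝒜' a (subset as a a∈M)
    ; model   = model as
    ; minimal = minimal-atoms 𝒜 𝒜' rs M as }
  shrink : IsAnswerSet (lp 𝒜' rs) M → IsAnswerSet (lp 𝒜 rs) M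
  shrink as = record
    { subset  = answerSet-⊆heads 𝒜 𝒜' rs M heads as
    ; model   = model as
    ; minimal = minimal-atoms 𝒜' 𝒜 rs M as }

cwv-transfer : (Π Π' : ELP) → eplits Π ≡ eplits Π' →
  (∀ Φ I → IsAnswerSet (epReduct Π Φ) I ⇔ IsAnswerSet (epReduct Π' Φ) I) →
  ∀ 𝓜 → IsCWV Π 𝓜 → IsCWV Π' 𝓜
cwv-transfer Π Π' sameLits sameAS 𝓜 (Φ , Φ⊆𝓔 , 𝓜≡AS , compatible) =
  Φ ,
  subst (λ 𝓔 → All (_∈ˡ 𝓔) Φ) sameLits Φ⊆𝓔 ,
  (λ I → ⇔.trans (𝓜≡AS I) (sameAS Φ I)) ,
  subst (λ 𝓔 → Compatible 𝓔 Φ 𝓜) sameLits compatible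

proposition2 : (Π Π' : ELP) →
    (∀ a → a ∈ˡ eatoms Π → a ∈ˡ eatoms Π') →
    eplits Π' ≡ eplits Π → erules Π' ≡ erules Π →
    ∀ (𝓜 : InterpSet) → IsCWV Π 𝓜 ⇔ IsCWV Π' 𝓜
proposition2 Π@(elp 𝒜 𝓔 𝓡 _ over) Π'@(elp 𝒜' _ _ _ _) 𝒜⊆𝒜' refl refl 𝓜 =
  mk⇔ (cwv-transfer Π Π' refl sameAS 𝓜)
      (cwv-transfer Π' Π refl (λ Φ I → ⇔.sym (sameAS Φ I)) 𝓜)
  where
  sameAS : ∀ Φ I → IsAnswerSet (epReduct Π Φ) I ⇔ IsAnswerSet (epReduct Π' Φ) I
  sameAS Φ = answerSet-enlarge 𝒜 𝒜' (reduceRules Φ 𝓡) 𝒜⊆𝒜'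
               (reduct-headsWithin 𝒜 Φ 𝓡 over)
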